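{- Let $q=p^m$ with $p$ prime and $m\in\mathbb{N}$, and let $k\in\mathbb{N}$ with $k\mid q-1$. The weak Waring number $w(k,q)$ exists if and only if the Waring number $g(k,q)$ exists, which in turn happens if and only if $\Gamma(k,q)$ is connected. In this case $$w(k,q)=\begin{cases} g(k,q) & \text{if $q$ is even, or $q$ is odd and } v_2(k)<v_2(q-1),\\ g(\tfrac k2,q) & \text{if $q$ is odd and } v_2(k)=v_2(q-1).\end{cases}$$ In other words, $w(k,q)=g(k,q)$ if $\Gamma(k,q)$ is undirected and $w(k,q)=g(\frac k2,q)$ if $\Gamma(k,q)$ is directed.
   Context: $R_k=\{x^k:x\in\mathbb{F}_q^*\}$; the generalized Paley graph $\Gamma(k,q)$ has vertex set $\mathbb{F}_q$ and an arc $x\to y$ iff $y-x\in R_k$; it is undirected if $R_k=-R_k$ and directed otherwise; connectedness means (strong) connectedness. The Waring number $g(k,q)$ is the least $s\in\mathbb{N}$ (if it exists) such that every $a\in\mathbb{F}_q$ can be written as $a=x_1^k+\cdots+x_s^k$ with $x_i\in\mathbb{F}_q$. The weak Waring number $w(k,q)$ is the least $s\in\mathbb{N}$ (if it exists) such that every $a\in\mathbb{F}_q$ can be written as $a=\pm x_1^k\pm\cdots\pm x_s^k$ with $x_i\in\mathbb{F}_q$ and independent choices of signs. $v_2$ is the $2$-adic valuation. -}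

module Defs where

open import Level using (0ℓ)
open import Data.Nat using (ℕ; zero; suc; _<_; _%_; _/_; _∸_; _^_)
open import Data.Nat.Divisibility using (_∣_)
open import Data.Nat.Primality using (Prime)
open import Data.Bool using (Bool; true; false)
open import Data.Fin using (Fin)
open import Data.Vec using (Vec; []; _∷_)
open import Data.Product using (Σ; ∃; ∃-syntax; _×_; _,_)
open import Relation.Nullary using (¬_)
open import Relation.Binary.PropositionalEquality using (_≡_; _≢_)
open import Algebra.Structures using (IsCommutativeRing)
open import Function.Bundles using (_↔_)

record FiniteField : Set₁ where
  infixl 7 _*_
  infixl 6 _+_
  field
    Carrier : Set
    _+_ _*_ : Carrier → Carrier → Carrier
    -_      : Carrier → Carrier
    0# 1#   : Carrier
    isCommutativeRing : IsCommutativeRing _≡_ _+_ _*_ -_ 0# 1#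
    0≢1     : 0# ≢ 1#
    inverse : ∀ x → x ≢ 0# → ∃[ y ] (x * y ≡ 1#)
    card    : ℕ
    enum    : Fin card ↔ Carrier

module _ (F : FiniteField) where
  open FiniteField F

  pow : Carrier → ℕ → Carrier
  pow x zero    = 1#
  pow x (suc n) = x * pow x n

  -- R_k = { x^k : x ∈ F* }
  InR : ℕ → Carrier → Set
  InR k y = ∃[ x ] (x ≢ 0# × y ≡ pow x k)

  sumPow : ℕ → ∀ {s} → Vec Carrier s → Carrier
  sumPow k []       = 0#
  sumPow k (x ∷ xs) = pow x k + sumPow k xs

  signed : Bool → Carrier → Carrier
  signed true  y = y
  signed false y = - y

  sumSignedPow : ℕ → ∀ {s} → Vec (Bool × Carrier) s → Carrier
  sumSignedPow k []              = 0#
  sumSignedPow k ((b , x) ∷ xs) = signed b (pow x k) + sumSignedPow k xs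

  AllSums : ℕ → ℕ → Set
  AllSums k s = ∀ a → ∃[ xs ] (a ≡ sumPow k {s} xs)

  AllSignedSums : ℕ → ℕ → Set
  AllSignedSums k s = ∀ a → ∃[ xs ] (a ≡ sumSignedPow k {s} xs)

  IsWaring : ℕ → ℕ → Set
  IsWaring k s = AllSums k s × (∀ t → t < s → ¬ AllSums k t)

  IsWeakWaring : ℕ → ℕ → Set
  IsWeakWaring k s = AllSignedSums k s × (∀ t → t < s → ¬ AllSignedSums k t)

  WaringExists : ℕ → Set
  WaringExists k = ∃[ s ] IsWaring k s

  WeakWaringExists : ℕ → Set
  WeakWaringExists k = ∃[ s ] IsWeakWaring k s

  -- Γ(k,q): arc x → y iff y - x ∈ R_k.  Directed-path reachability.
  data Reach (k : ℕ) (x : Carrier) : Carrier → Set where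
    here : Reach k x x
    step : ∀ {y z} → Reach k x y → InR k (z + (- y)) → Reach k x z

  Connected : ℕ → Set
  Connected k = ∀ x y → Reach k x y

  Undirected : ℕ → Set
  Undirected k = ∀ y → (InR k y → InR k (- y)) × (InR k (- y) → InR k y)

-- 2-adic valuation (v2 0 = 0 by convention; only used for n ≥ 1)

v2-go : ℕ → ℕ → ℕ
v2-go zero    n       = 0
v2-go (suc f) zero    = 0
v2-go (suc f) (suc n) with suc n % 2
... | zero  = suc (v2-go f (suc n / 2))
... | suc _ = 0

v2 : ℕ → ℕ
v2 n = v2-go n n

-- Write q = n + 1 and n = c k.  Since n · y = - y in a field of order q, a signed sum of t k-th powers
-- is an ordinary sum of t n k-th powers, so w(k,q) exists iff g(k,q) does; and the sums of k-th powers
-- are exactly the endpoints of paths from 0 in Γ(k,q), so g(k,q) exists iff Γ(k,q) is connected.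
-- For the value, compare ±R_k with a set of powers.  If - 1 ∈ R_k (i.e. Γ(k,q) is undirected) then
-- ±R_k = R_k and w = g(k,q).  Otherwise k = 2h with c odd, and Euler's criterion (y ≠ 0 is a d-th power
-- iff y ^ (n / d) = 1, proved by counting roots of polynomials) gives ±R_k ∪ {0} = R_h ∪ {0}, so
-- w = g(h,q).  Finally - 1 ∈ R_k iff q is even or c is even, and the parity of c is read off from the
-- 2-adic valuations of k and n = c k.
module Submission where

open import Defs
open import Level using (0ℓ)
open import Algebra.Bundles using (CommutativeMonoid; CommutativeRing)
open import Algebra.Structures using (IsCommutativeRing)
import Algebra.Properties.CommutativeMonoid.Sum
open import Data.Bool using (Bool; true; false)
open import Data.Fin using (Fin; zero; suc; punchIn; punchOut)
open import Data.Fin.Properties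
  using (any?; all?; inj⇒≟; 2↔Bool; punchInᵢ≢i; punchIn-injective; punchIn-punchOut)
open import Data.List as List using (List; []; _∷_; length; filter)
import Data.List.Properties as List
open import Data.List.Membership.Propositional using (_∈_)
open import Data.List.Membership.Propositional.Properties using (∈-tabulate⁺; ∈-tabulate⁻; ∈-filter⁺)
open import Data.List.Relation.Unary.All as All using (All; []; _∷_)
import Data.List.Relation.Unary.All.Properties as All
open import Data.List.Relation.Unary.AllPairs using ([]; _∷_)
open import Data.List.Relation.Unary.Any as Any using (here; there)
open import Data.List.Relation.Unary.Unique.Propositional using (Unique)
import Data.List.Relation.Unary.Unique.Propositional.Properties as Unique
open import Data.Nat as ℕ using (ℕ; zero; suc; _≤_; _<_; z≤n; s≤s; NonZero)
import Data.Nat.Properties as ℕ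
open import Data.Nat.DivMod using (m*n/n≡m; m/n<m; [m+kn]%n≡m%n; m*n%n≡0)
open import Data.Nat.Divisibility using (_∣_; _∣?_; divides; ∣1⇒≡1)
open import Data.Nat.Induction using (<-rec)
open import Data.Nat.Primality using (Prime; prime[2]; prime⇒nonZero; euclidsLemma; prime⇒irreducible)
open import Data.Nat.Tactic.RingSolver using (solve-∀)
open import Data.Product using (∃; ∃-syntax; _×_; _,_; proj₁; proj₂; map₂)
open import Data.Sum using (_⊎_; inj₁; inj₂; [_,_]′)
open import Data.Vec as Vec using (Vec; []; _∷_)
open import Function using (_∘_; _⇔_; _↔_; mk⇔; mk↔ₛ′; Inverse; Equivalence)
open import Function.Properties.Equivalence using () renaming (sym to ⇔-sym; trans to ⇔-trans)
open import Function.Properties.Inverse using (↔-sym; ↔-trans; ↔⇒↣)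
open import Relation.Nullary using (¬_; ¬?; Dec; yes; no; map′; contradiction)
open import Relation.Nullary.Decidable using (map)
open import Relation.Unary using (Decidable)
open import Relation.Unary.Properties using (∁?)
open import Relation.Binary.Definitions using (DecidableEquality)
open import Relation.Binary.PropositionalEquality

-- ℕ's _+_, _*_ and _^_ are opened only locally (here and before the main theorem): in FieldTheory
-- these names denote the field operations.
module _ where
  open import Data.Nat using (_+_; _*_; _^_; _⊔_; _%_; _/_)

  -- Parity, 2-adic valuation and prime powers

  parity : ∀ n → 2 ∣ n ⊎ ∃[ j ] n ≡ suc (j * 2)
  parity zero    = inj₁ (divides 0 refl)
  parity (suc n) with parity n
  ... | inj₁ (divides j n≡2j) = inj₂ (j , cong suc n≡2j)
  ... | inj₂ (j , n≡1+2j)     = inj₁ (divides (suc j) (cong suc n≡1+2j))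

  ¬2∣⇒odd : ∀ {n} → ¬ 2 ∣ n → ∃[ j ] n ≡ suc (j * 2)
  ¬2∣⇒odd {n} ¬2∣n with parity n
  ... | inj₁ 2∣n = contradiction 2∣n ¬2∣n
  ... | inj₂ odd = odd

  v2-go-fuel : ∀ {f g} n → n ≤ f → n ≤ g → v2-go f n ≡ v2-go g n
  v2-go-fuel {zero}  {zero}  zero _ _ = refl
  v2-go-fuel {zero}  {suc _} zero _ _ = refl
  v2-go-fuel {suc _} {zero}  zero _ _ = refl
  v2-go-fuel {suc _} {suc _} zero _ _ = refl
  v2-go-fuel {suc f} {suc g} (suc n) (s≤s n≤f) (s≤s n≤g) with suc n % 2
  ... | zero  = cong suc (v2-go-fuel (suc n / 2) (half≤ n≤f) (half≤ n≤g))
    where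
    half≤ : ∀ {h} → n ≤ h → suc n / 2 ≤ h
    half≤ n≤h = ℕ.≤-trans (ℕ.<⇒≤pred (m/n<m (suc n) 2 (s≤s (s≤s z≤n)))) n≤h
  ... | suc _ = refl

  v2-odd : ∀ j → v2 (suc (j * 2)) ≡ 0
  v2-odd j with suc (j * 2) % 2 | [m+kn]%n≡m%n 1 j 2
  ... | suc _ | _ = refl

  v2-double : ∀ j .{{_ : NonZero j}} → v2 (j * 2) ≡ suc (v2 j)
  v2-double (suc j) with suc (suc (j * 2)) % 2 | m*n%n≡0 (suc j) 2
  ... | zero | _ = cong suc (begin
    v2-go (suc (j * 2)) (suc (suc (j * 2)) / 2) ≡⟨ cong (v2-go (suc (j * 2))) (m*n/n≡m (suc j) 2) ⟩
    v2-go (suc (j * 2)) (suc j)                 ≡⟨ v2-go-fuel (suc j) (s≤s (ℕ.m≤m*n j 2)) ℕ.≤-refl ⟩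
    v2 (suc j)                                   ∎)
    where open ≡-Reasoning

  v2-2^*odd : ∀ i j → v2 (2 ^ i * suc (j * 2)) ≡ i
  v2-2^*odd zero    j = trans (cong v2 (ℕ.+-identityʳ (suc (j * 2)))) (v2-odd j)
  v2-2^*odd (suc i) j = begin
    v2 (2 * 2 ^ i * odd)   ≡⟨ cong v2 (trans (ℕ.*-assoc 2 (2 ^ i) odd) (ℕ.*-comm 2 (2 ^ i * odd))) ⟩
    v2 (2 ^ i * odd * 2)   ≡⟨ v2-double (2 ^ i * odd) {{ℕ.m*n≢0 (2 ^ i) odd {{ℕ.m^n≢0 2 i}}}} ⟩
    suc (v2 (2 ^ i * odd)) ≡⟨ cong suc (v2-2^*odd i j) ⟩
    suc i                    ∎
    where
    open ≡-Reasoning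
    odd = suc (j * 2)

  2^*odd-decomposition : ∀ n → ∃[ i ] ∃[ j ] suc n ≡ 2 ^ i * suc (j * 2)
  2^*odd-decomposition = <-rec _ halve
    where
    halve : ∀ n → (∀ {m} → m < n → ∃[ i ] ∃[ j ] suc m ≡ 2 ^ i * suc (j * 2)) →
            ∃[ i ] ∃[ j ] suc n ≡ 2 ^ i * suc (j * 2)
    halve n rec with parity n
    ... | inj₁ (divides j n≡2j) = 0 , j , cong suc (trans n≡2j (sym (ℕ.+-identityʳ (j * 2))))
    ... | inj₂ (m , n≡1+2m) with i , j , 1+m≡ ← rec (subst (m <_) (sym n≡1+2m) (s≤s (ℕ.m≤m*n m 2))) =
      suc i , j , (begin
        suc n                      ≡⟨ cong suc n≡1+2m ⟩
        suc m * 2                  ≡⟨ cong (_* 2) 1+m≡ ⟩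
        2 ^ i * odd * 2          ≡⟨ trans (ℕ.*-comm (2 ^ i * odd) 2) (sym (ℕ.*-assoc 2 (2 ^ i) odd)) ⟩
        2 * 2 ^ i * odd          ∎)
      where
      open ≡-Reasoning
      odd = suc (j * 2)

  v2-* : ∀ a b .{{_ : NonZero a}} .{{_ : NonZero b}} → v2 (a * b) ≡ v2 a + v2 b
  v2-* (suc a) (suc b)
    with i , j , a≡ ← 2^*odd-decomposition a | i′ , j′ , b≡ ← 2^*odd-decomposition b = begin
    v2 (suc a * suc b)                               ≡⟨ cong v2 (trans (cong₂ _*_ a≡ b≡) (product (2 ^ i) (2 ^ i′) j j′)) ⟩
    v2 (2 ^ i * 2 ^ i′ * suc (o * 2))                ≡⟨ cong (λ t → v2 (t * suc (o * 2))) (ℕ.^-distribˡ-+-* 2 i i′) ⟨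
    v2 (2 ^ (i + i′) * suc (o * 2))                  ≡⟨ v2-2^*odd (i + i′) o ⟩
    i + i′                                           ≡⟨ cong₂ _+_ (v2-2^*odd i j) (v2-2^*odd i′ j′) ⟨
    v2 (2 ^ i * suc (j * 2)) + v2 (2 ^ i′ * suc (j′ * 2)) ≡⟨ cong₂ (λ s t → v2 s + v2 t) a≡ b≡ ⟨
    v2 (suc a) + v2 (suc b)                          ∎
    where
    open ≡-Reasoning
    o = j + j′ + j * j′ * 2
    product : ∀ x y j j′ → (x * suc (j * 2)) * (y * suc (j′ * 2)) ≡ x * y * suc ((j + j′ + j * j′ * 2) * 2)
    product = solve-∀

  v2<v2*⇒2∣ : ∀ c k .{{_ : NonZero k}} → v2 k < v2 (c * k) → 2 ∣ c
  v2<v2*⇒2∣ c k v2k< with parity c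
  ... | inj₁ 2∣c          = 2∣c
  ... | inj₂ (j , refl)   = contradiction (trans (v2-* (suc (j * 2)) k) (cong (_+ v2 k) (v2-odd j))) (ℕ.>⇒≢ v2k<)

  v2≡v2*⇒¬2∣ : ∀ c k .{{_ : NonZero c}} .{{_ : NonZero k}} → v2 k ≡ v2 (c * k) → ¬ 2 ∣ c
  v2≡v2*⇒¬2∣ c k v2k≡ (divides j@(suc _) refl) =
    ℕ.m≢1+n+m (v2 k) (trans v2k≡ (trans (v2-* (j * 2) k) (cong (_+ v2 k) (v2-double j))))

  prime∣^⇒∣ : ∀ {r} p m → Prime r → r ∣ p ^ m → r ∣ p
  prime∣^⇒∣ p zero    r-prime r∣1 with refl ← ∣1⇒≡1 r∣1 = contradiction r-prime λ ()
  prime∣^⇒∣ p (suc m) r-prime r∣p*pᵐ with euclidsLemma p (p ^ m) r-prime r∣p*pᵐ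
  ... | inj₁ r∣p  = r∣p
  ... | inj₂ r∣pᵐ = prime∣^⇒∣ p m r-prime r∣pᵐ

  2∣prime^⇒≡2 : ∀ {p} m → Prime p → 2 ∣ p ^ m → p ≡ 2
  2∣prime^⇒≡2 {p} m p-prime 2∣pᵐ with prime⇒irreducible p-prime (prime∣^⇒∣ p m prime[2] 2∣pᵐ)
  ... | inj₂ 2≡p = sym 2≡p

  -- Least witnesses, counting and finite search

  IsLeast : (ℕ → Set) → ℕ → Set
  IsLeast P s = P s × (∀ t → t < s → ¬ P t)

  IsLeast-⇔ : ∀ {P Q : ℕ → Set} → (∀ t → P t ⇔ Q t) → ∀ {s} → IsLeast P s → IsLeast Q s
  IsLeast-⇔ P⇔Q (Ps , below) =
    Equivalence.to (P⇔Q _) Ps , λ t t<s Qt → below t t<s (Equivalence.from (P⇔Q t) Qt)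

  least : ∀ {P : ℕ → Set} → Decidable P → ∀ {s} → P s → ∃ (IsLeast P)
  least {P} P? {s} Ps with search (suc s)
    where
    search : ∀ b → ∃ (IsLeast P) ⊎ (∀ t → t < b → ¬ P t)
    search zero = inj₂ λ _ ()
    search (suc b) with search b | P? b
    ... | inj₁ found | _      = inj₁ found
    ... | inj₂ none  | yes Pb = inj₁ (b , Pb , none)
    ... | inj₂ none  | no ¬Pb =
      inj₂ λ t t<1+b → [ none t , (λ { refl → ¬Pb }) ]′ (ℕ.m<1+n⇒m<n∨m≡n t<1+b)
  ... | inj₁ found = found
  ... | inj₂ none  = contradiction Ps (none s ℕ.≤-refl)

  length-filter+∁ : ∀ {A : Set} {P : A → Set} (P? : Decidable P) xs →
                    length (filter P? xs) + length (filter (∁? P?) xs) ≡ length xs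
  length-filter+∁ P? []       = refl
  length-filter+∁ P? (x ∷ xs) with P? x
  ... | yes _ = cong suc (length-filter+∁ P? xs)
  ... | no  _ = trans (ℕ.+-suc _ _) (cong suc (length-filter+∁ P? xs))

  pigeonhole : ∀ {A B : Set} (_≟_ : DecidableEquality B) (f : A → B) {d} →
               (∀ {b xs} → Unique xs → All (λ x → f x ≡ b) xs → length xs ≤ d) →
               ∀ {xs} → Unique xs → ∀ bs → All (λ x → f x ∈ bs) xs → length xs ≤ length bs * d
  pigeonhole _≟_ f fibre≤ {[]}    _ _  _        = z≤n
  pigeonhole _≟_ f fibre≤ {_ ∷ _} _ [] (() ∷ _)
  pigeonhole _≟_ f {d} fibre≤ {xs} xs! (b ∷ bs) f[xs]⊆b∷bs = begin
    length xs                                               ≡⟨ length-filter+∁ hits xs ⟨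
    length (filter hits xs) + length (filter (∁? hits) xs)  ≤⟨ ℕ.+-mono-≤ fibre≤b rest≤ ⟩
    d + length bs * d                                       ∎
    where
    open ℕ.≤-Reasoning
    hits = λ x → f x ≟ b
    fibre≤b = fibre≤ (Unique.filter⁺ hits xs!) (All.all-filter hits xs)
    drop-b : ∀ {x} → f x ∈ b ∷ bs × ¬ f x ≡ b → f x ∈ bs
    drop-b (here fx≡b , fx≢b) = contradiction fx≡b fx≢b
    drop-b (there fx∈bs , _)  = fx∈bs
    rest≤ = pigeonhole _≟_ f fibre≤ (Unique.filter⁺ (∁? hits) xs!) bs
              (All.zipWith drop-b (All.filter⁺ (∁? hits) f[xs]⊆b∷bs , All.all-filter (∁? hits) xs))

  Searchable : Set → Set₁
  Searchable A = ∀ {P : A → Set} → Decidable P → Dec (∃ P)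

  ×-searchable : ∀ {A B : Set} → Searchable A → Searchable B → Searchable (A × B)
  ×-searchable ∃A? ∃B? P? =
    map′ (λ (a , b , p) → (a , b) , p) (λ ((a , b) , p) → a , b , p) (∃A? λ a → ∃B? λ b → P? (a , b))

  uniform-bound : ∀ {m} (P : Fin m → ℕ → Set) → (∀ i {s t} → s ≤ t → P i s → P i t) →
                  (∀ i → ∃ (P i)) → ∃[ T ] ∀ i → P i T
  uniform-bound {zero}  P mono bounded = 0 , λ ()
  uniform-bound {suc m} P mono bounded
    with s , P₀s ← bounded zero | T , P₊T ← uniform-bound (P ∘ suc) (mono ∘ suc) (bounded ∘ suc) =
    s ⊔ T , λ where
      zero    → mono zero (ℕ.m≤m⊔n s T) P₀s
      (suc i) → mono (suc i) (ℕ.m≤n⊔m s T) (P₊T i)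

  module _ {A : Set} {m} (enum : Fin m ↔ A) where
    open Inverse enum

    ↔-searchable : Searchable A
    ↔-searchable {P} P? =
      map′ (λ (i , Pi) → to i , Pi) (λ (x , Px) → from x , subst P (sym (strictlyInverseˡ x)) Px)
           (any? (P? ∘ to))

    ↔-∀? : ∀ {P : A → Set} → Decidable P → Dec (∀ x → P x)
    ↔-∀? {P} P? =
      map′ (λ ∀P x → subst P (strictlyInverseˡ x) (∀P (from x))) (λ ∀P i → ∀P (to i)) (all? (P? ∘ to))

    ↔-uniform-bound : (P : A → ℕ → Set) → (∀ x {s t} → s ≤ t → P x s → P x t) →
                      (∀ x → ∃ (P x)) → ∃[ T ] ∀ x → P x T
    ↔-uniform-bound P mono bounded with T , P∘to ← uniform-bound (P ∘ to) (mono ∘ to) (bounded ∘ to) =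
      T , λ x → subst (λ y → P y T) (strictlyInverseˡ x) (P∘to (from x))

  module _ {c ℓ} (M : CommutativeMonoid c ℓ) {A : Set} {m} (enum : Fin m ↔ A) where
    open CommutativeMonoid M using (_≈_) renaming (Carrier to M₀; trans to ≈-trans; reflexive to ≈-reflexive)
    open Algebra.Properties.CommutativeMonoid.Sum M using (sum; sum-permute; sum-cong-≗)
    open Inverse enum

    sum-↔ : (σ : A ↔ A) (g : A → M₀) → sum (g ∘ to) ≈ sum (g ∘ Inverse.to σ ∘ to)
    sum-↔ σ g = ≈-trans (sum-permute (g ∘ to) (↔-trans enum (↔-trans σ (↔-sym enum))))
                        (≈-reflexive (sum-cong-≗ λ i → cong g (strictlyInverseˡ (Inverse.to σ (to i)))))

module FieldTheory (F : FiniteField) where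

  open FiniteField F
  open IsCommutativeRing isCommutativeRing
    using (+-assoc; +-comm; +-identityˡ; +-identityʳ; -‿inverseˡ; -‿inverseʳ;
           *-assoc; *-comm; *-identityˡ; *-identityʳ; zeroˡ; zeroʳ)

  commutativeRing : CommutativeRing 0ℓ 0ℓ
  commutativeRing = record { isCommutativeRing = isCommutativeRing }

  open CommutativeRing commutativeRing
    using (ring; semiring; commutativeSemiring; +-commutativeMonoid; *-commutativeMonoid)
  open import Algebra.Properties.Ring ring
    using (-‿involutive; -0#≈0#; -1*x≈-x; +-inverseˡ-unique; +-inverseʳ-unique; +-identityʳ-unique;
           x∙y⁻¹≈ε⇒x≈y; //-rightDividesˡ; //-rightDividesʳ)
  open import Algebra.Properties.CommutativeSemiring.Exp commutativeSemiring
    using (_^_; ^-homo-*; ^-assocʳ; ^-distrib-*)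
  open import Algebra.Properties.Semiring.Mult semiring using (×-assoc-*; ×1-homo-*) renaming (_×_ to _·_)
  -- The ring solvers need coefficients that compute, so only the semiring one applies here: a negation - a
  -- enters it as an independent atom, and a + - a ≡ 0# is used by hand.
  open import Algebra.Solver.Ring.NaturalCoefficients.Default commutativeSemiring
    using (solve; _:+_; _:*_; _:=_; con)
  open ≡-Reasoning

  -- Arithmetic in a finite field

  infix 4 _≟_
  _≟_ : DecidableEquality Carrier
  _≟_ = inj⇒≟ (↔⇒↣ (↔-sym enum))

  ∃? : Searchable Carrier
  ∃? = ↔-searchable enum

  ∀? : ∀ {P : Carrier → Set} → Decidable P → Dec (∀ x → P x)
  ∀? = ↔-∀? enum

  x-y≡z⇔x≡y+z : ∀ {x y z} → x + - y ≡ z ⇔ x ≡ y + z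
  x-y≡z⇔x≡y+z {x} {y} {z} = mk⇔
    (λ x-y≡z → trans (sym (//-rightDividesˡ y x)) (trans (cong (_+ y) x-y≡z) (+-comm z y)))
    (λ x≡y+z → trans (cong (_+ - y) (trans x≡y+z (+-comm y z))) (//-rightDividesʳ y z))

  1≢0 : 1# ≢ 0#
  1≢0 = 0≢1 ∘ sym

  -‿≢0 : ∀ {x} → x ≢ 0# → - x ≢ 0#
  -‿≢0 {x} x≢0 -x≡0 = x≢0 (trans (sym (-‿involutive x)) (trans (cong -_ -x≡0) -0#≈0#))

  -1≢0 : - 1# ≢ 0#
  -1≢0 = -‿≢0 1≢0

  scaling : ∀ {x} → x ≢ 0# → Carrier ↔ Carrier
  scaling {x} x≢0 = mk↔ₛ′ (x *_) (x⁻¹ *_) (cancel xx⁻¹≡1) (cancel (trans (*-comm x⁻¹ x) xx⁻¹≡1))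
    where
    x⁻¹ = proj₁ (inverse x x≢0)
    xx⁻¹≡1 = proj₂ (inverse x x≢0)
    cancel : ∀ {a b} → a * b ≡ 1# → ∀ y → a * (b * y) ≡ y
    cancel {a} {b} ab≡1 y = trans (sym (*-assoc a b y)) (trans (cong (_* y) ab≡1) (*-identityˡ y))

  *-cancelˡ : ∀ {x y z} → x ≢ 0# → x * y ≡ x * z → y ≡ z
  *-cancelˡ {y = y} {z} x≢0 xy≡xz =
    trans (sym (strictlyInverseʳ y)) (trans (cong from xy≡xz) (strictlyInverseʳ z))
    where open Inverse (scaling x≢0)

  x*y≡0⇒ : ∀ {x y} → x * y ≡ 0# → x ≡ 0# ⊎ y ≡ 0#
  x*y≡0⇒ {x} xy≡0 with x ≟ 0#
  ... | yes x≡0 = inj₁ x≡0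
  ... | no  x≢0 = inj₂ (*-cancelˡ x≢0 (trans xy≡0 (sym (zeroʳ x))))

  *-≢0 : ∀ {x y} → x ≢ 0# → y ≢ 0# → x * y ≢ 0#
  *-≢0 x≢0 y≢0 = [ x≢0 , y≢0 ]′ ∘ x*y≡0⇒

  ^-≢0 : ∀ {x} n → x ≢ 0# → x ^ n ≢ 0#
  ^-≢0 zero    x≢0 = 1≢0
  ^-≢0 (suc n) x≢0 = *-≢0 x≢0 (^-≢0 n x≢0)

  ^≡0⇒≡0 : ∀ {x} n → x ^ n ≡ 0# → x ≡ 0#
  ^≡0⇒≡0 {x} n xⁿ≡0 with x ≟ 0#
  ... | yes x≡0 = x≡0
  ... | no  x≢0 = contradiction xⁿ≡0 (^-≢0 n x≢0)

  0^-nonZero : ∀ n .{{_ : NonZero n}} → 0# ^ n ≡ 0#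
  0^-nonZero (suc n) = zeroˡ _

  1^ : ∀ n → 1# ^ n ≡ 1#
  1^ zero    = refl
  1^ (suc n) = trans (*-identityˡ _) (1^ n)

  -1^-even : ∀ {c} → 2 ∣ c → (- 1#) ^ c ≡ 1#
  -1^-even (divides j refl) = begin
    (- 1#) ^ (j ℕ.* 2) ≡⟨ cong ((- 1#) ^_) (ℕ.*-comm j 2) ⟩
    (- 1#) ^ (2 ℕ.* j) ≡⟨ ^-assocʳ (- 1#) 2 j ⟨
    ((- 1#) ^ 2) ^ j   ≡⟨ cong (_^ j) -1² ⟩
    1# ^ j             ≡⟨ 1^ j ⟩
    1#                 ∎
    where
    -1² : (- 1#) ^ 2 ≡ 1#
    -1² = trans (cong (- 1# *_) (*-identityʳ (- 1#))) (trans (-1*x≈-x (- 1#)) (-‿involutive 1#))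

  -1^-odd : ∀ {c} → ¬ 2 ∣ c → (- 1#) ^ c ≡ - 1#
  -1^-odd ¬2∣c with j , refl ← ¬2∣⇒odd ¬2∣c =
    trans (cong (- 1# *_) (-1^-even (divides j refl))) (*-identityʳ (- 1#))

  x²≡1⇒ : ∀ {x} → x * x ≡ 1# → x ≡ 1# ⊎ x ≡ - 1#
  x²≡1⇒ {x} x²≡1 with x*y≡0⇒ factored
    where
    factored : (x + - 1#) * (x + 1#) ≡ 0#
    factored = begin
      (x + - 1#) * (x + 1#)           ≡⟨ solve 2 (λ x m → (x :+ m) :* (x :+ con 1) := x :* x :+ m :+ x :* (m :+ con 1))
                                                 refl x (- 1#) ⟩
      x * x + - 1# + x * (- 1# + 1#)  ≡⟨ cong (λ t → x * x + - 1# + x * t) (-‿inverseˡ 1#) ⟩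
      x * x + - 1# + x * 0#           ≡⟨ trans (cong (x * x + - 1# +_) (zeroʳ x)) (+-identityʳ _) ⟩
      x * x + - 1#                    ≡⟨ cong (_+ - 1#) x²≡1 ⟩
      1# + - 1#                       ≡⟨ -‿inverseʳ 1# ⟩
      0#                              ∎
  ... | inj₁ x-1≡0 = inj₁ (x∙y⁻¹≈ε⇒x≈y x 1# x-1≡0)
  ... | inj₂ x+1≡0 = inj₂ (+-inverseˡ-unique x 1# x+1≡0)

  -- Roots of polynomials

  -- A list of length d codes the monic polynomial c₀ + c₁ x + … + c_{d-1} x^{d-1} + x^d in Horner form.
  evalMonic : List Carrier → Carrier → Carrier
  evalMonic []       x = 1#
  evalMonic (c ∷ cs) x = c + x * evalMonic cs x

  deflate : Carrier → List Carrier → List Carrier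
  deflate a []               = []
  deflate a (_ ∷ [])         = []
  deflate a (_ ∷ cs@(_ ∷ _)) = evalMonic cs a ∷ deflate a cs

  deflate-length : ∀ a c cs → suc (length (deflate a (c ∷ cs))) ≡ length (c ∷ cs)
  deflate-length a c []       = refl
  deflate-length a c (d ∷ ds) = cong suc (deflate-length a d ds)

  x+[a-a]*y≡x : ∀ a x y → x + (a + - a) * y ≡ x
  x+[a-a]*y≡x a x y =
    trans (cong (λ t → x + t * y) (-‿inverseʳ a)) (trans (cong (x +_) (zeroˡ y)) (+-identityʳ x))

  remainder-theorem : ∀ a c cs x →
    evalMonic (c ∷ cs) x ≡ (x + - a) * evalMonic (deflate a (c ∷ cs)) x + evalMonic (c ∷ cs) a
  remainder-theorem a c [] x = begin
    c + x * 1#                                   ≡⟨ x+[a-a]*y≡x a (c + x * 1#) 1# ⟨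
    c + x * 1# + (a + - a) * 1#                  ≡⟨ solve 4 (λ a b c x → (x :+ b) :* con 1 :+ (c :+ a :* con 1)
                                                                    := c :+ x :* con 1 :+ (a :+ b) :* con 1)
                                                             refl a (- a) c x ⟨
    (x + - a) * 1# + (c + a * 1#)                ∎
  remainder-theorem a c cs@(d ∷ ds) x = begin
    c + x * evalMonic cs x                       ≡⟨ cong (λ t → c + x * t) (remainder-theorem a d ds x) ⟩
    c + x * ((x + - a) * S + Q)                  ≡⟨ x+[a-a]*y≡x a (c + x * ((x + - a) * S + Q)) Q ⟨
    c + x * ((x + - a) * S + Q) + (a + - a) * Q  ≡⟨ solve 6 (λ a b c x S Q →
                                                                 (x :+ b) :* (Q :+ x :* S) :+ (c :+ a :* Q)
                                                                 := c :+ x :* ((x :+ b) :* S :+ Q) :+ (a :+ b) :* Q)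
                                                             refl a (- a) c x S Q ⟨
    (x + - a) * (Q + x * S) + (c + a * Q)        ∎
    where
    S = evalMonic (deflate a cs) x
    Q = evalMonic cs a

  deflate-root : ∀ {a r} c cs → evalMonic (c ∷ cs) a ≡ 0# → evalMonic (c ∷ cs) r ≡ 0# → a ≢ r →
                 evalMonic (deflate a (c ∷ cs)) r ≡ 0#
  deflate-root {a} {r} c cs Pa≡0 Pr≡0 a≢r with x*y≡0⇒ [r-a]Qr≡0
    where
    Qr = evalMonic (deflate a (c ∷ cs)) r
    [r-a]Qr≡0 : (r + - a) * Qr ≡ 0#
    [r-a]Qr≡0 = begin
      (r + - a) * Qr                         ≡⟨ +-identityʳ _ ⟨
      (r + - a) * Qr + 0#                    ≡⟨ cong ((r + - a) * Qr +_) Pa≡0 ⟨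
      (r + - a) * Qr + evalMonic (c ∷ cs) a  ≡⟨ remainder-theorem a c cs r ⟨
      evalMonic (c ∷ cs) r                   ≡⟨ Pr≡0 ⟩
      0#                                     ∎
  ... | inj₁ r-a≡0 = contradiction (sym (x∙y⁻¹≈ε⇒x≈y r a r-a≡0)) a≢r
  ... | inj₂ Qr≡0  = Qr≡0

  monic-roots≤degree : ∀ cs {rs} → Unique rs → All (λ r → evalMonic cs r ≡ 0#) rs → length rs ≤ length cs
  monic-roots≤degree cs       {[]}     _            _              = z≤n
  monic-roots≤degree []       {_ ∷ _}  _            (1≡0 ∷ _)      = contradiction 1≡0 1≢0
  monic-roots≤degree (c ∷ cs) {a ∷ rs} (a∉rs ∷ rs!) (Pa≡0 ∷ Prs≡0) =
    subst (length (a ∷ rs) ≤_) (deflate-length a c cs) (s≤s (monic-roots≤degree (deflate a (c ∷ cs)) rs!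
      (All.zipWith (λ (a≢r , Pr≡0) → deflate-root c cs Pa≡0 Pr≡0 a≢r) (a∉rs , Prs≡0))))

  evalMonic-zeros : ∀ m x → evalMonic (List.replicate m 0#) x ≡ x ^ m
  evalMonic-zeros zero    x = refl
  evalMonic-zeros (suc m) x = trans (+-identityˡ _) (cong (x *_) (evalMonic-zeros m x))

  power-roots≤ : ∀ d .{{_ : NonZero d}} y {rs} → Unique rs → All (λ r → r ^ d ≡ y) rs → length rs ≤ d
  power-roots≤ (suc m) y {rs} rs! rᵈ≡y =
    subst (length rs ≤_) (cong suc (List.length-replicate m))
      (monic-roots≤degree (- y ∷ List.replicate m 0#) rs! (All.map root rᵈ≡y))
    where
    root : ∀ {r} → r ^ suc m ≡ y → evalMonic (- y ∷ List.replicate m 0#) r ≡ 0#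
    root {r} rᵈ≡y = begin
      - y + r * evalMonic (List.replicate m 0#) r  ≡⟨ cong (λ t → - y + r * t) (evalMonic-zeros m r) ⟩
      - y + r ^ suc m                              ≡⟨ cong (- y +_) rᵈ≡y ⟩
      - y + y                                      ≡⟨ -‿inverseˡ y ⟩
      0#                                           ∎

  -- Sums of powers, Waring numbers and Γ(k,q)

  sumMap : ∀ {A : Set} {t} → (A → Carrier) → Vec A t → Carrier
  sumMap f []       = 0#
  sumMap f (x ∷ xs) = f x + sumMap f xs

  SumOf : ∀ {A : Set} → (A → Carrier) → ℕ → Carrier → Set
  SumOf {A} f t a = ∃[ xs ] a ≡ sumMap {A} {t} f xs

  Spans : ∀ {A : Set} → (A → Carrier) → ℕ → Set
  Spans f t = ∀ a → SumOf f t a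

  SameImage : ∀ {A B : Set} → (A → Carrier) → (B → Carrier) → Set
  SameImage f g = (∀ x → ∃[ y ] f x ≡ g y) × (∀ y → ∃[ x ] g y ≡ f x)

  module _ {A : Set} (f : A → Carrier) where

    SumOf? : Searchable A → ∀ t a → Dec (SumOf f t a)
    SumOf? ∃A? zero    a = map′ ([] ,_) (λ { ([] , a≡0) → a≡0 }) (a ≟ 0#)
    SumOf? ∃A? (suc t) a = map′
      (λ (x , xs , a-fx≡Σ) → x ∷ xs , Equivalence.to x-y≡z⇔x≡y+z a-fx≡Σ)
      (λ { (x ∷ xs , a≡fx+Σ) → x , xs , Equivalence.from x-y≡z⇔x≡y+z a≡fx+Σ })
      (∃A? λ x → SumOf? ∃A? t (a + - f x))

    Spans? : Searchable A → ∀ t → Dec (Spans f t)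
    Spans? ∃A? t = ∀? (SumOf? ∃A? t)

    Spans⇔sums : ∀ {Σ′ : ∀ {t} → Vec A t → Carrier} → (∀ {t} (xs : Vec A t) → Σ′ xs ≡ sumMap f xs) →
                 ∀ t → Spans f t ⇔ (∀ a → ∃[ xs ] a ≡ Σ′ {t} xs)
    Spans⇔sums Σ′≗Σ t = mk⇔ (λ spans a → map₂ (λ {xs} a≡ → trans a≡ (sym (Σ′≗Σ xs))) (spans a))
                        (λ spans a → map₂ (λ {xs} a≡ → trans a≡ (Σ′≗Σ xs)) (spans a))

    sumMap-++ : ∀ {s t} (xs : Vec A s) (ys : Vec A t) → sumMap f (xs Vec.++ ys) ≡ sumMap f xs + sumMap f ys
    sumMap-++ []       ys = sym (+-identityˡ _)
    sumMap-++ (x ∷ xs) ys = trans (cong (f x +_) (sumMap-++ xs ys)) (sym (+-assoc _ _ _))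

    SumOf-+ : ∀ {s t a b} → SumOf f s a → SumOf f t b → SumOf f (s ℕ.+ t) (a + b)
    SumOf-+ (xs , a≡) (ys , b≡) = xs Vec.++ ys , trans (cong₂ _+_ a≡ b≡) (sym (sumMap-++ xs ys))

    SumOf-zeros : ∀ {z} → f z ≡ 0# → ∀ t → SumOf f t 0#
    SumOf-zeros fz≡0 zero    = [] , refl
    SumOf-zeros fz≡0 (suc t) with zs , 0≡Σ ← SumOf-zeros fz≡0 t =
      _ ∷ zs , sym (trans (cong₂ _+_ fz≡0 (sym 0≡Σ)) (+-identityˡ 0#))

    SumOf-pad : ∀ {z} → f z ≡ 0# → ∀ {s t a} → s ≤ t → SumOf f s a → SumOf f t a
    SumOf-pad fz≡0 {s} {a = a} s≤t Σa with o , refl ← ℕ.m≤n⇒∃[o]m+o≡n s≤t =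
      subst (SumOf f (s ℕ.+ o)) (+-identityʳ a) (SumOf-+ Σa (SumOf-zeros fz≡0 o))

    sumMap-replicate : ∀ m x → sumMap f (Vec.replicate m x) ≡ m · f x
    sumMap-replicate zero    x = refl
    sumMap-replicate (suc m) x = cong (f x +_) (sumMap-replicate m x)

  module _ {A B : Set} {f : A → Carrier} {g : B → Carrier} where

    SumOf-termwise : (∀ x → ∃[ y ] f x ≡ g y) → ∀ {t a} → SumOf f t a → SumOf g t a
    SumOf-termwise f⊆g (xs , a≡) = let ys , Σ≡ = termwise xs in ys , trans a≡ Σ≡
      where
      termwise : ∀ {t} (xs : Vec A t) → ∃[ ys ] sumMap f xs ≡ sumMap {t = t} g ys
      termwise []       = [] , refl
      termwise (x ∷ xs) = let y , fx≡gy = f⊆g x ; ys , Σ≡ = termwise xs in y ∷ ys , cong₂ _+_ fx≡gy Σ≡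

    SumOf-blocks : ∀ {m} → (∀ x → SumOf g m (f x)) → ∀ {t a} → SumOf f t a → SumOf g (t ℕ.* m) a
    SumOf-blocks {m} fx∈Σg (xs , a≡) = subst (SumOf g _) (sym a≡) (blocks xs)
      where
      blocks : ∀ {t} (xs : Vec A t) → SumOf g (t ℕ.* m) (sumMap f xs)
      blocks []       = [] , refl
      blocks (x ∷ xs) = SumOf-+ g (fx∈Σg x) (blocks xs)

  SameImage⇒Spans⇔ : ∀ {A B : Set} {f : A → Carrier} {g : B → Carrier} →
                     SameImage f g → ∀ t → Spans f t ⇔ Spans g t
  SameImage⇒Spans⇔ (f⊆g , g⊆f) t =
    mk⇔ (λ Σf a → SumOf-termwise f⊆g (Σf a)) (λ Σg a → SumOf-termwise g⊆f (Σg a))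

  power : ℕ → Carrier → Carrier
  power k x = x ^ k

  signedPower : ℕ → Bool × Carrier → Carrier
  signedPower k (b , x) = signed F b (x ^ k)

  pow≡^ : ∀ x k → pow F x k ≡ x ^ k
  pow≡^ x zero    = refl
  pow≡^ x (suc k) = cong (x *_) (pow≡^ x k)

  Spans⇔AllSums : ∀ k t → Spans (power k) t ⇔ AllSums F k t
  Spans⇔AllSums k = Spans⇔sums (power k) sumPow≡
    where
    sumPow≡ : ∀ {t} (xs : Vec Carrier t) → sumPow F k xs ≡ sumMap (power k) xs
    sumPow≡ []       = refl
    sumPow≡ (x ∷ xs) = cong₂ _+_ (pow≡^ x k) (sumPow≡ xs)

  Spans⇔AllSignedSums : ∀ k t → Spans (signedPower k) t ⇔ AllSignedSums F k t
  Spans⇔AllSignedSums k = Spans⇔sums (signedPower k) sumSignedPow≡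
    where
    sumSignedPow≡ : ∀ {t} (xs : Vec (Bool × Carrier) t) → sumSignedPow F k xs ≡ sumMap (signedPower k) xs
    sumSignedPow≡ []             = refl
    sumSignedPow≡ ((b , x) ∷ xs) = cong₂ (λ y s → signed F b y + s) (pow≡^ x k) (sumSignedPow≡ xs)

  AllSums? : ∀ k t → Dec (AllSums F k t)
  AllSums? k t = map (Spans⇔AllSums k t) (Spans? (power k) ∃? t)

  AllSignedSums? : ∀ k t → Dec (AllSignedSums F k t)
  AllSignedSums? k t =
    map (Spans⇔AllSignedSums k t) (Spans? (signedPower k) (×-searchable (↔-searchable 2↔Bool) ∃?) t)

  IsWeakWaring⇒IsWaring : ∀ {k k′} → SameImage (signedPower k) (power k′) →
                          ∀ {w} → IsWeakWaring F k w → IsWaring F k′ w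
  IsWeakWaring⇒IsWaring {k} {k′} same = IsLeast-⇔ λ t →
    ⇔-trans (⇔-sym (Spans⇔AllSignedSums k t)) (⇔-trans (SameImage⇒Spans⇔ same t) (Spans⇔AllSums k′ t))

  InR⇔ : ∀ k y → InR F k y ⇔ (∃[ x ] x ≢ 0# × y ≡ x ^ k)
  InR⇔ k y = mk⇔ (λ (x , x≢0 , y≡) → x , x≢0 , trans y≡ (pow≡^ x k))
                 (λ (x , x≢0 , y≡) → x , x≢0 , trans y≡ (sym (pow≡^ x k)))

  -[xᵏ]≡[ux]ᵏ : ∀ {k u} → - 1# ≡ u ^ k → ∀ x → - (x ^ k) ≡ (u * x) ^ k
  -[xᵏ]≡[ux]ᵏ {k} {u} -1≡uᵏ x = begin
    - (x ^ k)      ≡⟨ -1*x≈-x (x ^ k) ⟨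
    - 1# * x ^ k   ≡⟨ cong (_* x ^ k) -1≡uᵏ ⟩
    u ^ k * x ^ k  ≡⟨ ^-distrib-* u x k ⟨
    (u * x) ^ k    ∎

  -1∈R⇒SameImage : ∀ {k u} → - 1# ≡ u ^ k → SameImage (signedPower k) (power k)
  -1∈R⇒SameImage {k} {u} -1≡uᵏ =
    (λ { (true , x) → x , refl ; (false , x) → u * x , -[xᵏ]≡[ux]ᵏ {k} {u} -1≡uᵏ x }) ,
    (λ y → (true , y) , refl)

  Undirected⇒-1∈R : ∀ {k} → Undirected F k → ∃[ u ] u ≢ 0# × - 1# ≡ u ^ k
  Undirected⇒-1∈R {k} undirected = Equivalence.to (InR⇔ k (- 1#)) (proj₁ (undirected 1#) 1∈R)
    where
    1∈R : InR F k 1#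
    1∈R = 1# , 1≢0 , sym (trans (pow≡^ 1# k) (1^ k))

  -1∈R⇒Undirected : ∀ {k u} → u ≢ 0# → - 1# ≡ u ^ k → Undirected F k
  -1∈R⇒Undirected {k} {u} u≢0 -1≡uᵏ y =
    -R⊆R , λ -y∈R → subst (InR F k) (-‿involutive y) (-R⊆R -y∈R)
    where
    -R⊆R : ∀ {y} → InR F k y → InR F k (- y)
    -R⊆R (x , x≢0 , y≡xᵏ) = Equivalence.from (InR⇔ k _)
      (u * x , *-≢0 u≢0 x≢0 , trans (cong -_ (trans y≡xᵏ (pow≡^ x k))) (-[xᵏ]≡[ux]ᵏ {k} {u} -1≡uᵏ x))

  char2⇒Undirected : ∀ {k} → 1# + 1# ≡ 0# → Undirected F k
  char2⇒Undirected {k} 1+1≡0 =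
    -1∈R⇒Undirected {k} 1≢0 (trans (sym (+-inverseˡ-unique 1# 1# 1+1≡0)) (sym (1^ k)))

  Undirected⇒IsWaring : ∀ {k} → Undirected F k → ∀ {w} → IsWeakWaring F k w → IsWaring F k w
  Undirected⇒IsWaring {k} undirected with _ , _ , -1≡uᵏ ← Undirected⇒-1∈R {k} undirected =
    IsWeakWaring⇒IsWaring (-1∈R⇒SameImage {k} -1≡uᵏ)

  module _ {k} .{{_ : NonZero k}} where

    Reach-+^ : ∀ {x y} z → Reach F k x y → Reach F k x (z ^ k + y)
    Reach-+^ {x} {y} z x⇝y with z ≟ 0#
    ... | yes refl = subst (Reach F k x) (sym (trans (cong (_+ y) (0^-nonZero k)) (+-identityˡ y))) x⇝y
    ... | no  z≢0  = step x⇝y (z , z≢0 , trans (//-rightDividesʳ y (z ^ k)) (sym (pow≡^ z k)))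

    Reach-+Σ : ∀ {x y t} (zs : Vec Carrier t) → Reach F k x y → Reach F k x (sumMap (power k) zs + y)
    Reach-+Σ {x} {y} []       x⇝y = subst (Reach F k x) (sym (+-identityˡ y)) x⇝y
    Reach-+Σ {x} {y} (z ∷ zs) x⇝y = subst (Reach F k x) (sym (+-assoc _ _ y)) (Reach-+^ z (Reach-+Σ zs x⇝y))

    Spans⇒Connected : ∀ {t} → Spans (power k) t → Connected F k
    Spans⇒Connected spans x y with zs , y-x≡Σ ← spans (y + - x) =
      subst (Reach F k x) (sym (trans (Equivalence.to x-y≡z⇔x≡y+z y-x≡Σ) (+-comm x _))) (Reach-+Σ zs here)

    Reach⇒SumOf : ∀ {a} → Reach F k 0# a → ∃[ t ] SumOf (power k) t a
    Reach⇒SumOf here = 0 , [] , refl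
    Reach⇒SumOf (step {y} {z} 0⇝y (w , _ , z-y≡wᵏ)) with t , ws , y≡Σ ← Reach⇒SumOf 0⇝y =
      suc t , w ∷ ws , trans (Equivalence.to x-y≡z⇔x≡y+z (trans z-y≡wᵏ (pow≡^ w k)))
                             (trans (+-comm y _) (cong (w ^ k +_) y≡Σ))

    Connected⇒Spans : Connected F k → ∃ (Spans (power k))
    Connected⇒Spans connected = ↔-uniform-bound enum (λ a t → SumOf (power k) t a)
      (λ _ → SumOf-pad (power k) (0^-nonZero k)) (λ a → Reach⇒SumOf (connected 0# a))

    WaringExists⇔Connected : WaringExists F k ⇔ Connected F k
    WaringExists⇔Connected = mk⇔
      (λ (s , allSums , _) → Spans⇒Connected (Equivalence.from (Spans⇔AllSums k s) allSums))
      (λ connected → let T , spans = Connected⇒Spans connected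
                     in least (AllSums? k) (Equivalence.to (Spans⇔AllSums k T) spans))

  -- Fields of order n + 1

  module Σ = Algebra.Properties.CommutativeMonoid.Sum +-commutativeMonoid
  module Π = Algebra.Properties.CommutativeMonoid.Sum *-commutativeMonoid

  ∏-≢0 : ∀ {m} (f : Fin m → Carrier) → (∀ i → f i ≢ 0#) → Π.sum f ≢ 0#
  ∏-≢0 {zero}  f f≢0 = 1≢0
  ∏-≢0 {suc m} f f≢0 = *-≢0 (f≢0 zero) (∏-≢0 (f ∘ suc) (f≢0 ∘ suc))

  ifNonzero : Carrier → Carrier → Carrier
  ifNonzero y x with y ≟ 0#
  ... | yes _ = 1#
  ... | no  _ = x

  ifNonzero-≡0 : ∀ {y} x → y ≡ 0# → ifNonzero y x ≡ 1#
  ifNonzero-≡0 {y} x y≡0 with y ≟ 0#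
  ... | yes _   = refl
  ... | no  y≢0 = contradiction y≡0 y≢0

  ifNonzero-≢0 : ∀ {y} x → y ≢ 0# → ifNonzero y x ≡ x
  ifNonzero-≢0 {y} x y≢0 with y ≟ 0#
  ... | yes y≡0 = contradiction y≡0 y≢0
  ... | no  _   = refl

  ifNonzero-self-≢0 : ∀ y → ifNonzero y y ≢ 0#
  ifNonzero-self-≢0 y with y ≟ 0#
  ... | yes _   = 1≢0
  ... | no  y≢0 = y≢0

  ifNonzero-* : ∀ {x} → x ≢ 0# → ∀ y → ifNonzero (x * y) (x * y) ≡ ifNonzero y x * ifNonzero y y
  ifNonzero-* {x} x≢0 y with y ≟ 0#
  ... | yes y≡0 = trans (ifNonzero-≡0 (x * y) (trans (cong (x *_) y≡0) (zeroʳ x))) (sym (*-identityˡ 1#))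
  ... | no  y≢0 = ifNonzero-≢0 (x * y) (*-≢0 x≢0 y≢0)

  module Order {n} (card≡1+n : card ≡ suc n) where

    elements : Fin (suc n) ↔ Carrier
    elements = subst (λ c → Fin c ↔ Carrier) card≡1+n enum

    open Inverse elements using (to; from; strictlyInverseˡ; strictlyInverseʳ)

    0-index : Fin (suc n)
    0-index = from 0#

    nonzero-element : ∀ j → to (punchIn 0-index j) ≢ 0#
    nonzero-element j to[j]≡0 = punchInᵢ≢i 0-index j (trans (sym (strictlyInverseʳ _)) (cong from to[j]≡0))

    n≢0 : n ≢ 0
    n≢0 n≡0 = 1≢0 (trans (sym (strictlyInverseˡ 1#))
                         (trans (cong to (Fin1-trivial (from 1#) (from 0#))) (strictlyInverseˡ 0#)))
      where
      Fin1-trivial : (i j : Fin (suc n)) → i ≡ j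
      Fin1-trivial = subst (λ m → (i j : Fin (suc m)) → i ≡ j) (sym n≡0) λ { zero zero → refl }

    characteristic : suc n · 1# ≡ 0#
    characteristic = +-identityʳ-unique (Σ.sum to) (suc n · 1#) (sym (begin
      Σ.sum to                             ≡⟨ sum-↔ +-commutativeMonoid elements shift (λ y → y) ⟩
      Σ.sum (λ i → to i + 1#)              ≡⟨ Σ.∑-distrib-+ to (λ _ → 1#) ⟩
      Σ.sum to + Σ.sum {suc n} (λ _ → 1#)  ≡⟨ cong (Σ.sum to +_) (Σ.sum-replicate (suc n)) ⟩
      Σ.sum to + suc n · 1#                ∎))
      where
      shift : Carrier ↔ Carrier
      shift = mk↔ₛ′ (_+ 1#) (_+ - 1#) (//-rightDividesˡ 1#) (//-rightDividesʳ 1#)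

    -y≡n·y : ∀ y → - y ≡ n · y
    -y≡n·y y = sym (+-inverseʳ-unique y (n · y) (begin
      suc n · y         ≡⟨ cong (suc n ·_) (*-identityˡ y) ⟨
      suc n · (1# * y)  ≡⟨ ×-assoc-* (suc n) 1# y ⟨
      (suc n · 1#) * y  ≡⟨ cong (_* y) characteristic ⟩
      0# * y            ≡⟨ zeroˡ y ⟩
      0#                ∎))

    even-order⇒char2 : ∀ {p m} → Prime p → suc n ≡ p ℕ.^ m → 2 ∣ suc n → 1# + 1# ≡ 0#
    even-order⇒char2 {p} {m} p-prime q≡pᵐ 2∣q with refl ← 2∣prime^⇒≡2 m p-prime (subst (2 ∣_) q≡pᵐ 2∣q) =
      ^≡0⇒≡0 m (trans (sym (2ᵐ·1≡[1+1]ᵐ m)) (trans (cong (_· 1#) (sym q≡pᵐ)) characteristic))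
      where
      2ᵐ·1≡[1+1]ᵐ : ∀ m → (2 ℕ.^ m) · 1# ≡ (1# + 1#) ^ m
      2ᵐ·1≡[1+1]ᵐ zero    = +-identityʳ 1#
      2ᵐ·1≡[1+1]ᵐ (suc m) =
        trans (×1-homo-* 2 (2 ℕ.^ m)) (cong₂ _*_ (cong (1# +_) (+-identityʳ 1#)) (2ᵐ·1≡[1+1]ᵐ m))

    odd-order⇒char≢2 : ¬ 2 ∣ suc n → 1# + 1# ≢ 0#
    odd-order⇒char≢2 ¬2∣q 1+1≡0 with j , refl ← ¬2∣⇒odd ¬2∣q = 1≢0 (begin
      1#                        ≡⟨ +-identityʳ 1# ⟨
      1# + 0#                   ≡⟨ cong (1# +_) (zeroʳ (j · 1#)) ⟨
      1# + (j · 1#) * 0#        ≡⟨ cong (λ t → 1# + (j · 1#) * t) (trans (cong (1# +_) (+-identityʳ 1#)) 1+1≡0) ⟨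
      1# + (j · 1#) * (2 · 1#)  ≡⟨ cong (1# +_) (×1-homo-* j 2) ⟨
      suc (j ℕ.* 2) · 1#        ≡⟨ characteristic ⟩
      0#                        ∎)

    ∏-ifNonzero : ∀ x → Π.sum (λ i → ifNonzero (to i) x) ≡ x ^ n
    ∏-ifNonzero x = begin
      Π.sum (λ i → ifNonzero (to i) x)
        ≡⟨ Π.sum-remove {i = 0-index} (λ i → ifNonzero (to i) x) ⟩
      ifNonzero (to 0-index) x * Π.sum (λ j → ifNonzero (to (punchIn 0-index j)) x)
        ≡⟨ cong₂ _*_ (ifNonzero-≡0 x (strictlyInverseˡ 0#))
                     (Π.sum-cong-≗ (λ j → ifNonzero-≢0 x (nonzero-element j))) ⟩
      1# * Π.sum {n} (λ _ → x)
        ≡⟨ trans (*-identityˡ _) (Π.sum-replicate n) ⟩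
      x ^ n
        ∎

    -- P, the product of the nonzero elements, is invariant under y ↦ x * y, which multiplies it by x ^ n.
    fermat : ∀ {x} → x ≢ 0# → x ^ n ≡ 1#
    fermat {x} x≢0 = *-cancelˡ (∏-≢0 (orOne ∘ to) (ifNonzero-self-≢0 ∘ to)) (begin
      P * x ^ n                                        ≡⟨ *-comm P (x ^ n) ⟩
      x ^ n * P                                        ≡⟨ cong (_* P) (∏-ifNonzero x) ⟨
      Π.sum (λ i → ifNonzero (to i) x) * P             ≡⟨ Π.∑-distrib-+ (λ i → ifNonzero (to i) x) (orOne ∘ to) ⟨
      Π.sum (λ i → ifNonzero (to i) x * orOne (to i))  ≡⟨ Π.sum-cong-≗ (λ i → ifNonzero-* x≢0 (to i)) ⟨
      Π.sum (λ i → orOne (x * to i))                   ≡⟨ sum-↔ *-commutativeMonoid elements (scaling x≢0) orOne ⟨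
      P                                                ≡⟨ *-identityʳ P ⟨
      P * 1#                                           ∎)
      where
      orOne : Carrier → Carrier
      orOne y = ifNonzero y y
      P = Π.sum (orOne ∘ to)

    nonzeros : List Carrier
    nonzeros = List.tabulate (to ∘ punchIn 0-index)

    nonzeros-unique : Unique nonzeros
    nonzeros-unique = Unique.tabulate⁺ λ {i} {j} to[i]≡to[j] → punchIn-injective 0-index i j
      (trans (sym (strictlyInverseʳ _)) (trans (cong from to[i]≡to[j]) (strictlyInverseʳ _)))

    ∈nonzeros : ∀ {x} → x ≢ 0# → x ∈ nonzeros
    ∈nonzeros {x} x≢0 = subst (_∈ nonzeros) (trans (cong to (punchIn-punchOut 0≢x)) (strictlyInverseˡ x))
                             (∈-tabulate⁺ (punchOut 0≢x))
      where
      0≢x : 0-index ≢ from x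
      0≢x from0≡fromx =
        x≢0 (trans (sym (strictlyInverseˡ x)) (trans (cong to (sym from0≡fromx)) (strictlyInverseˡ 0#)))

    ∈nonzeros⁻ : ∀ {x} → x ∈ nonzeros → x ≢ 0#
    ∈nonzeros⁻ x∈ with j , refl ← ∈-tabulate⁻ x∈ = nonzero-element j

    -- If y is no d-th power, x ↦ x ^ d maps the n nonzero elements into the roots of z ^ e ≡ 1# other
    -- than y, hitting each at most d times; there are fewer than e of them, so n < e * d.
    euler-criterion : ∀ {d e} → d ℕ.* e ≡ n → ∀ {y} → y ≢ 0# → y ^ e ≡ 1# → ∃[ x ] x ≢ 0# × y ≡ x ^ d
    euler-criterion {zero}      0≡n   = contradiction (sym 0≡n) n≢0
    euler-criterion {d} {zero}  d*0≡n = contradiction (trans (sym d*0≡n) (ℕ.*-zeroʳ d)) n≢0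
    euler-criterion {d@(suc _)} {e@(suc _)} de≡n {y} y≢0 yᵉ≡1 with ∃? (λ x → y ≟ x ^ d)
    ... | yes (x , y≡xᵈ) =
      x , (λ x≡0 → y≢0 (trans y≡xᵈ (trans (cong (_^ d) x≡0) (0^-nonZero d)))) , y≡xᵈ
    ... | no  ¬found     = contradiction n<n (ℕ.<-irrefl refl)
      where
      roots = filter (λ z → z ^ e ≟ 1#) nonzeros
      others = filter (λ z → ¬? (z ≟ y)) roots
      y∈roots : y ∈ roots
      y∈roots = ∈-filter⁺ (λ z → z ^ e ≟ 1#) (∈nonzeros y≢0) yᵉ≡1
      image : ∀ {x} → x ∈ nonzeros → x ^ d ∈ others
      image {x} x∈ = ∈-filter⁺ (λ z → ¬? (z ≟ y))
        (∈-filter⁺ (λ z → z ^ e ≟ 1#) (∈nonzeros (^-≢0 d (∈nonzeros⁻ x∈)))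
          (trans (^-assocʳ x d e) (trans (cong (x ^_) de≡n) (fermat (∈nonzeros⁻ x∈)))))
        (λ xᵈ≡y → ¬found (x , sym xᵈ≡y))
      n≤|others|*d : n ≤ length others ℕ.* d
      n≤|others|*d = subst (_≤ length others ℕ.* d) (List.length-tabulate (to ∘ punchIn 0-index))
        (pigeonhole _≟_ (_^ d) (power-roots≤ d _) nonzeros-unique others (All.tabulate image))
      |others|<e : length others < e
      |others|<e = ℕ.<-≤-trans
        (List.filter-notAll _ roots (Any.map (λ { refl ¬¬y≡y → ¬¬y≡y refl }) y∈roots))
        (power-roots≤ e 1# (Unique.filter⁺ _ nonzeros-unique) (All.all-filter _ nonzeros))
      n<n : n < n
      n<n = ℕ.≤-<-trans n≤|others|*d
        (ℕ.<-≤-trans (ℕ.*-monoˡ-< d |others|<e) (ℕ.≤-reflexive (trans (ℕ.*-comm e d) de≡n)))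

    module _ {k} .{{_ : NonZero k}} where

      signedPower-as-sum : ∀ bx → SumOf (power k) n (signedPower k bx)
      signedPower-as-sum (true , x)  =
        SumOf-pad (power k) (0^-nonZero k) (ℕ.n≢0⇒n>0 n≢0) (x ∷ [] , sym (+-identityʳ (x ^ k)))
      signedPower-as-sum (false , x) =
        Vec.replicate n x , trans (-y≡n·y (x ^ k)) (sym (sumMap-replicate (power k) n x))

      WeakWaringExists⇔WaringExists : WeakWaringExists F k ⇔ WaringExists F k
      WeakWaringExists⇔WaringExists = mk⇔
        (λ (w , allSigned , _) → least (AllSums? k) (Equivalence.to (Spans⇔AllSums k (w ℕ.* n))
           λ a → SumOf-blocks signedPower-as-sum (Equivalence.from (Spans⇔AllSignedSums k w) allSigned a)))
        (λ (s , allSums , _) → least (AllSignedSums? k) (Equivalence.to (Spans⇔AllSignedSums k s)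
           λ a → SumOf-termwise (λ x → (true , x) , refl) (Equivalence.from (Spans⇔AllSums k s) allSums a)))

    even-cofactor⇒Undirected : ∀ {c k} → n ≡ c ℕ.* k → 2 ∣ c → Undirected F k
    even-cofactor⇒Undirected {c} {k} n≡ck 2∣c =
      let u , u≢0 , -1≡uᵏ = euler-criterion {k} {c} (trans (ℕ.*-comm k c) (sym n≡ck)) -1≢0 (-1^-even 2∣c)
      in -1∈R⇒Undirected {k} u≢0 -1≡uᵏ

    odd-cofactor⇒¬Undirected : ∀ {c k} → 1# + 1# ≢ 0# → n ≡ c ℕ.* k → ¬ 2 ∣ c → ¬ Undirected F k
    odd-cofactor⇒¬Undirected {c} {k} 1+1≢0 n≡ck ¬2∣c undirected
      with u , u≢0 , -1≡uᵏ ← Undirected⇒-1∈R {k} undirected =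
      1+1≢0 (trans (cong (1# +_) (sym -1≡1)) (-‿inverseʳ 1#))
      where
      -1≡1 : - 1# ≡ 1#
      -1≡1 = begin
        - 1#           ≡⟨ -1^-odd ¬2∣c ⟨
        (- 1#) ^ c     ≡⟨ cong (_^ c) -1≡uᵏ ⟩
        (u ^ k) ^ c    ≡⟨ ^-assocʳ u k c ⟩
        u ^ (k ℕ.* c)  ≡⟨ cong (u ^_) (trans (ℕ.*-comm k c) (sym n≡ck)) ⟩
        u ^ n          ≡⟨ fermat u≢0 ⟩
        1#             ∎

    ¬Undirected⇒even : ∀ {k} → ¬ Undirected F k → 2 ∣ k
    ¬Undirected⇒even {k} ¬undirected with 2 ∣? k
    ... | yes 2∣k = 2∣k
    ... | no ¬2∣k = contradiction (-1∈R⇒Undirected {k} -1≢0 (sym (-1^-odd ¬2∣k))) ¬undirected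

    module _ {c h} (n≡c[2h] : n ≡ c ℕ.* (h ℕ.* 2)) (¬2∣c : ¬ 2 ∣ c) where

      private
        h[2c]≡n : h ℕ.* (c ℕ.* 2) ≡ n
        h[2c]≡n = trans (rearrange h c) (sym n≡c[2h])
          where
          rearrange : ∀ h c → h ℕ.* (c ℕ.* 2) ≡ c ℕ.* (h ℕ.* 2)
          rearrange = solve-∀

        [2h]c≡n : h ℕ.* 2 ℕ.* c ≡ n
        [2h]c≡n = trans (ℕ.*-comm (h ℕ.* 2) c) (sym n≡c[2h])

        instance
          h-nonZero : NonZero h
          h-nonZero = ℕ.≢-nonZero λ { refl → n≢0 (trans n≡c[2h] (ℕ.*-zeroʳ c)) }

        x²ʰ≡[x²]ʰ : ∀ x → x ^ (h ℕ.* 2) ≡ (x ^ 2) ^ h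
        x²ʰ≡[x²]ʰ x = trans (cong (x ^_) (ℕ.*-comm h 2)) (sym (^-assocʳ x 2 h))

      signedPower⊆power : ∀ bx → ∃[ y ] signedPower (h ℕ.* 2) bx ≡ y ^ h
      signedPower⊆power (true , x)  = x ^ 2 , x²ʰ≡[x²]ʰ x
      signedPower⊆power (false , x)
        with u , _ , -1≡uʰ ← euler-criterion {h} {c ℕ.* 2} h[2c]≡n -1≢0 (-1^-even (divides c refl)) =
        u * x ^ 2 , trans (cong -_ (x²ʰ≡[x²]ʰ x)) (-[xᵏ]≡[ux]ᵏ {h} {u} -1≡uʰ (x ^ 2))

      private
        [yʰ]ᶜ[yʰ]ᶜ≡1 : ∀ {y} → y ≢ 0# → (y ^ h) ^ c * (y ^ h) ^ c ≡ 1#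
        [yʰ]ᶜ[yʰ]ᶜ≡1 {y} y≢0 = begin
          (y ^ h) ^ c * (y ^ h) ^ c  ≡⟨ ^-homo-* (y ^ h) c c ⟨
          (y ^ h) ^ (c ℕ.+ c)        ≡⟨ cong ((y ^ h) ^_) (trans (cong (c ℕ.+_) (sym (ℕ.+-identityʳ c)))
                                                                 (ℕ.*-comm 2 c)) ⟩
          (y ^ h) ^ (c ℕ.* 2)        ≡⟨ ^-assocʳ y h (c ℕ.* 2) ⟩
          y ^ (h ℕ.* (c ℕ.* 2))      ≡⟨ cong (y ^_) h[2c]≡n ⟩
          y ^ n                      ≡⟨ fermat y≢0 ⟩
          1#                         ∎

        [-z]ᶜ≡1 : ∀ {z} → z ^ c ≡ - 1# → (- z) ^ c ≡ 1#
        [-z]ᶜ≡1 {z} zᶜ≡-1 = begin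
          (- z) ^ c           ≡⟨ cong (_^ c) (-1*x≈-x z) ⟨
          (- 1# * z) ^ c      ≡⟨ ^-distrib-* (- 1#) z c ⟩
          (- 1#) ^ c * z ^ c  ≡⟨ cong₂ _*_ (-1^-odd ¬2∣c) zᶜ≡-1 ⟩
          - 1# * - 1#         ≡⟨ -1*x≈-x (- 1#) ⟩
          - - 1#              ≡⟨ -‿involutive 1# ⟩
          1#                  ∎

      -- z := y ^ h has (z ^ c) ^ 2 ≡ y ^ n ≡ 1#, so z ^ c ≡ ± 1#, and then Euler's criterion makes ± z
      -- a (2h)-th power.
      power⊆signedPower : ∀ y → ∃[ bx ] y ^ h ≡ signedPower (h ℕ.* 2) bx
      power⊆signedPower y with y ≟ 0#
      ... | yes refl = (true , 0#) , trans (0^-nonZero h) (sym (0^-nonZero (h ℕ.* 2) {{ℕ.m*n≢0 h 2}}))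
      ... | no  y≢0  = [ plus , minus ]′ (x²≡1⇒ ([yʰ]ᶜ[yʰ]ᶜ≡1 y≢0))
        where
        plus : (y ^ h) ^ c ≡ 1# → ∃[ bx ] y ^ h ≡ signedPower (h ℕ.* 2) bx
        plus zᶜ≡1 with x , _ , z≡x²ʰ ← euler-criterion {h ℕ.* 2} {c} [2h]c≡n (^-≢0 h y≢0) zᶜ≡1 =
          (true , x) , z≡x²ʰ
        minus : (y ^ h) ^ c ≡ - 1# → ∃[ bx ] y ^ h ≡ signedPower (h ℕ.* 2) bx
        minus zᶜ≡-1
          with x , _ , -z≡x²ʰ ← euler-criterion {h ℕ.* 2} {c} [2h]c≡n (-‿≢0 (^-≢0 h y≢0)) ([-z]ᶜ≡1 zᶜ≡-1) =
          (false , x) , trans (sym (-‿involutive (y ^ h))) (cong -_ -z≡x²ʰ)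

    ¬Undirected⇒IsWaring : ∀ {k} → k ∣ n → ¬ Undirected F k →
                           ∀ {w} → IsWeakWaring F k w → IsWaring F (k ℕ./ 2) w
    ¬Undirected⇒IsWaring {k} (divides c n≡ck) ¬undirected {w} weak
      with divides h refl ← ¬Undirected⇒even {k} ¬undirected =
      subst (λ k′ → IsWaring F k′ w) (sym (m*n/n≡m h 2)) (IsWeakWaring⇒IsWaring
        (signedPower⊆power {c} {h} n≡ck ¬2∣c , power⊆signedPower {c} {h} n≡ck ¬2∣c) weak)
      where
      ¬2∣c : ¬ 2 ∣ c
      ¬2∣c 2∣c = ¬undirected (even-cofactor⇒Undirected {c} {h ℕ.* 2} n≡ck 2∣c)

open import Data.Nat using (ℕ; _^_; _∸_; _<_; _/_)
open import Data.Nat.Divisibility using (_∣_)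
open import Data.Nat.Primality using (Prime)
open import Data.Product using (_×_)
open import Data.Sum using (_⊎_)
open import Relation.Nullary using (¬_)
open import Relation.Binary.PropositionalEquality using (_≡_)
open import Function.Bundles using (_⇔_)
open FiniteField using (card)

theorem8p3 : (p m : ℕ) → Prime p → (F : FiniteField) → card F ≡ p ^ m →
    (k : ℕ) → k ∣ (p ^ m ∸ 1) →
    ((WeakWaringExists F k ⇔ WaringExists F k) × (WaringExists F k ⇔ Connected F k))
    × (∀ w → IsWeakWaring F k w →
        ((2 ∣ p ^ m ⊎ (¬ (2 ∣ p ^ m) × v2 k < v2 (p ^ m ∸ 1))) → IsWaring F k w)
        × ((¬ (2 ∣ p ^ m) × v2 k ≡ v2 (p ^ m ∸ 1)) → IsWaring F (k / 2) w)
        × (Undirected F k → IsWaring F k w)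
        × (¬ Undirected F k → IsWaring F (k / 2) w))
theorem8p3 p m p-prime F card≡q k k∣n@(divides c n≡ck) =
  (WeakWaringExists⇔WaringExists , WaringExists⇔Connected) , λ w weak →
      [ (λ 2∣q → Undirected⇒IsWaring (2∣q⇒undirected 2∣q) weak)
      , (λ (_ , v2k<v2n) → Undirected⇒IsWaring (v2<⇒undirected v2k<v2n) weak) ]′
    , (λ (¬2∣q , v2k≡v2n) → ¬Undirected⇒IsWaring k∣n (v2≡⇒directed ¬2∣q v2k≡v2n) weak)
    , (λ undirected → Undirected⇒IsWaring undirected weak)
    , (λ ¬undirected → ¬Undirected⇒IsWaring k∣n ¬undirected weak)
  where
  q≡1+n : p ^ m ≡ suc (p ^ m ∸ 1)
  q≡1+n = sym (ℕ.m+[n∸m]≡n (ℕ.m^n>0 p {{prime⇒nonZero p-prime}} m))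
  open FieldTheory F
  open Order (trans card≡q q≡1+n)
  instance
    c-nonZero : NonZero c
    c-nonZero = ℕ.≢-nonZero λ { refl → n≢0 n≡ck }
    k-nonZero : NonZero k
    k-nonZero = ℕ.≢-nonZero λ { refl → n≢0 (trans n≡ck (ℕ.*-zeroʳ c)) }
  2∣q⇒undirected : 2 ∣ p ^ m → Undirected F k
  2∣q⇒undirected 2∣q =
    char2⇒Undirected {k} (even-order⇒char2 {p} {m} p-prime (sym q≡1+n) (subst (2 ∣_) q≡1+n 2∣q))
  v2<⇒undirected : v2 k < v2 (p ^ m ∸ 1) → Undirected F k
  v2<⇒undirected v2k<v2n =
    even-cofactor⇒Undirected {c} {k} n≡ck (v2<v2*⇒2∣ c k (subst (λ t → v2 k < v2 t) n≡ck v2k<v2n))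
  v2≡⇒directed : ¬ 2 ∣ p ^ m → v2 k ≡ v2 (p ^ m ∸ 1) → ¬ Undirected F k
  v2≡⇒directed ¬2∣q v2k≡v2n =
    odd-cofactor⇒¬Undirected {c} {k} (odd-order⇒char≢2 (subst (λ t → ¬ 2 ∣ t) q≡1+n ¬2∣q))
                                      n≡ck (v2≡v2*⇒¬2∣ c k (trans v2k≡v2n (cong v2 n≡ck)))
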